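{- Let $T[1,n]$ be a string over a totally ordered alphabet $\Sigma$, such that $T[n]=\texttt{\$}$ is strictly smaller than every other symbol and occurs nowhere else in $T$. Let $p_1<\cdots<p_m=n$ be its LMS positions, $D$ its set of distinct LMS substrings, and $T'[1,m]$, $S\!A'$, $BWT'$, $t_j$ and $F_j$ as defined in the context. Let $S$ be a string that appears as a left-maximal suffix in $D$. Let $j<j'$ be two positions of $BWT'$ with $t_j<m$ and $t_{j'}<m$, such that $S$ is a proper suffix of both $F_j$ and $F_{j'}$. Then the suffix $T[p_{t_j+1}-|S|+1,\,n]$ is lexicographically smaller than the suffix $T[p_{t_{j'}+1}-|S|+1,\,n]$, i.e., it precedes it in the suffix array of $T$.
   Context: Symbol types: $T[n]$ is S-type. For $i<n$, $T[i]$ is S-type if $T[i]<T[i+1]$, or if $T[i]=T[i+1]$ and $T[i+1]$ is S-type; otherwise L-type. A position $i>1$ is LMS if $T[i]$ is S-type and $T[i-1]$ is L-type. The LMS substrings are $T[p_t,p_{t+1}]$ for $1\le t<m$, and $T[n,n]$. Order $\prec_{LMS}$ on distinct strings $X,Y$: $X\prec_{LMS}Y$ if $Y$ is a proper prefix of $X$, or if neither is a prefix of the other and $X$ is lexicographically smaller than $Y$. (A string ranks higher than any string of which it is a proper prefix.) Parse: $T'[t]$ is the rank, in $\prec_{LMS}$ order, of $T[p_t,p_{t+1}]$ among the strings of $D$ for $t<m$, and $T'[m]$ is the rank of $T[n,n]$. $S\!A'$ is the suffix array of $T'$, and $BWT'[j]=T'[S\!A'[j]-1]$ with $T'[0]=T'[m]$.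 For a position $j$ of $BWT'$, let $t_j=S\!A'[j]-1$ if $S\!A'[j]>1$ and $t_j=m$ otherwise. The phrase of $BWT'[j]$ is $F_j=T[p_{t_j},p_{t_j+1}]$ if $t_j<m$ and $F_j=T[n,n]$ if $t_j=m$. Left-maximal: a string $S$ appears as a left-maximal suffix in $D$ if there exist two distinct $X,Y\in D$, both having $S$ as a suffix, such that either $S$ is a proper suffix of both and the symbols immediately preceding $S$ in $X$ and in $Y$ differ, or $S$ equals $X$ or $Y$. -}

module Defs where

open import Data.Nat using (ℕ; zero; suc; _+_; _∸_; _≤_; _<ᵇ_) renaming (_<_ to _<ℕ_)
open import Data.Bool using (if_then_else_)
open import Data.List using (List; []; _∷_; _++_; applyUpTo; length)
open import Data.List.Membership.Propositional using (_∈_)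
open import Data.List.Relation.Unary.Unique.Propositional using (Unique)
open import Data.Product using (∃; _×_; _,_)
open import Data.Sum using (_⊎_)
open import Relation.Binary.PropositionalEquality using (_≡_; _≢_)
open import Relation.Nullary using (¬_)
open import Function.Bundles using (_⇔_)

-- Strings are 1-indexed: a string T[1,n] is a function T : ℕ → A of which
-- only the values at 1..n are relevant (n is always passed alongside).

sub : {A : Set} → (ℕ → A) → ℕ → ℕ → List A
sub T a b = applyUpTo (λ k → T (a + k)) (suc b ∸ a)

Prefix : {A : Set} → List A → List A → Set
Prefix X Y = ∃ λ Z → Y ≡ X ++ Z

LexLt : {A : Set} → (A → A → Set) → List A → List A → Set
LexLt R X Y =
  (∃ λ Z → Z ≢ [] × Y ≡ X ++ Z) ⊎
  (∃ λ u → ∃ λ a → ∃ λ b → ∃ λ v → ∃ λ w →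
     X ≡ u ++ (a ∷ v) × Y ≡ u ++ (b ∷ w) × R a b)

LMSLt : {A : Set} → (A → A → Set) → List A → List A → Set
LMSLt R X Y =
  (∃ λ Z → Z ≢ [] × X ≡ Y ++ Z) ⊎
  (¬ Prefix X Y × ¬ Prefix Y X × LexLt R X Y)

-- S-type positions of T[1,n] (least fixed point of the defining recursion).
data SType {A : Set} (_⊏_ : A → A → Set) (T : ℕ → A) (n : ℕ) : ℕ → Set where
  s-last : SType _⊏_ T n n
  s-lt   : ∀ {i} → suc i ≤ n → T i ⊏ T (suc i) → SType _⊏_ T n i
  s-eq   : ∀ {i} → suc i ≤ n → T i ≡ T (suc i) → SType _⊏_ T n (suc i) →
           SType _⊏_ T n i

LType : {A : Set} → (A → A → Set) → (ℕ → A) → ℕ → ℕ → Set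
LType _⊏_ T n i = 1 ≤ i × i ≤ n × ¬ SType _⊏_ T n i

IsLMS : {A : Set} → (A → A → Set) → (ℕ → A) → ℕ → ℕ → Set
IsLMS _⊏_ T n i = 1 <ℕ i × i ≤ n × SType _⊏_ T n i × LType _⊏_ T n (i ∸ 1)

IsLMSEnum : {A : Set} → (A → A → Set) → (ℕ → A) → ℕ → ℕ → (ℕ → ℕ) → Set
IsLMSEnum _⊏_ T n m p =
  (∀ t → 1 ≤ t → t <ℕ m → p t <ℕ p (suc t)) ×
  (∀ t → 1 ≤ t → t ≤ m → IsLMS _⊏_ T n (p t)) ×
  (∀ i → IsLMS _⊏_ T n i → ∃ λ t → 1 ≤ t × t ≤ m × p t ≡ i)

phr : {A : Set} → (ℕ → A) → ℕ → ℕ → (ℕ → ℕ) → ℕ → List A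
phr T n m p t = if t <ᵇ m then sub T (p t) (p (suc t)) else sub T n n

InD : {A : Set} → (ℕ → A) → ℕ → ℕ → (ℕ → ℕ) → List A → Set
InD T n m p X =
  (∃ λ t → 1 ≤ t × t <ℕ m × X ≡ sub T (p t) (p (suc t))) ⊎ X ≡ sub T n n

-- r is the (1-based) rank of X among the strings of D in ≺_LMS order:
-- r = 1 + #{ Y ∈ D | Y ≺_LMS X }.
IsRank : {A : Set} → (A → A → Set) → (ℕ → A) → ℕ → ℕ → (ℕ → ℕ) →
         List A → ℕ → Set
IsRank _⊏_ T n m p X r =
  ∃ λ (L : List _) → Unique L ×
    (∀ Y → (Y ∈ L) ⇔ (InD T n m p Y × LMSLt _⊏_ Y X)) ×
    r ≡ suc (length L)

IsParse : {A : Set} → (A → A → Set) → (ℕ → A) → ℕ → ℕ → (ℕ → ℕ) →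
          (ℕ → ℕ) → Set
IsParse _⊏_ T n m p T′ =
  ∀ t → 1 ≤ t → t ≤ m → IsRank _⊏_ T n m p (phr T n m p t) (T′ t)

IsSA : (ℕ → ℕ) → ℕ → (ℕ → ℕ) → Set
IsSA U m SA =
  (∀ j → 1 ≤ j → j ≤ m → 1 ≤ SA j × SA j ≤ m) ×
  (∀ i → 1 ≤ i → i ≤ m → ∃ λ j → 1 ≤ j × j ≤ m × SA j ≡ i) ×
  (∀ j j′ → 1 ≤ j → j <ℕ j′ → j′ ≤ m →
     LexLt _<ℕ_ (sub U (SA j) m) (sub U (SA j′) m))

tj : (ℕ → ℕ) → ℕ → ℕ → ℕ
tj SA m j = if 1 <ᵇ SA j then SA j ∸ 1 else m

Fj : {A : Set} → (ℕ → A) → ℕ → ℕ → (ℕ → ℕ) → (ℕ → ℕ) → ℕ → List A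
Fj T n m p SA j = phr T n m p (tj SA m j)

Suffix : {A : Set} → List A → List A → Set
Suffix S X = ∃ λ U → X ≡ U ++ S

ProperSuffix : {A : Set} → List A → List A → Set
ProperSuffix S X = ∃ λ U → U ≢ [] × X ≡ U ++ S

LeftMaximal : {A : Set} → (ℕ → A) → ℕ → ℕ → (ℕ → ℕ) → List A → Set
LeftMaximal T n m p S =
  ∃ λ X → ∃ λ Y → InD T n m p X × InD T n m p Y × X ≢ Y ×
    Suffix S X × Suffix S Y ×
    ((∃ λ U → ∃ λ V → ∃ λ a → ∃ λ b →
        X ≡ U ++ (a ∷ S) × Y ≡ V ++ (b ∷ S) × a ≢ b)
     ⊎ S ≡ X ⊎ S ≡ Y)

-- Order the suffixes of T starting at LMS positions by the parse. If T′[a..m] < T′[b..m], the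
-- leading phrases of equal rank are equal, and consecutive phrases share their boundary symbol,
-- so T[p_a..] and T[p_b..] agree up to the first pair of phrases a, b of different ranks. There
-- phrase a ≺_LMS phrase b: either they differ at some symbol, or phrase b is a proper prefix of
-- phrase a. In the latter case the copy inside phrase a of the LMS position p_{b+1} is not LMS,
-- hence L-type, and an L-type suffix precedes an S-type suffix starting with the same symbol.
-- Thus T[p_{t_j+1}..] < T[p_{t_j′+1}..], and both positions end an occurrence of S, so
-- prepending S preserves the order.
module Submission where

open import Defs
open import Data.Nat using (ℕ; zero; suc; _+_; _∸_; _≤_; _<_; z≤n; s≤s; z<s; _<ᵇ_)
open import Data.Nat.Properties
open import Data.Bool using (true; false)
open import Data.List using (List; []; _∷_; _++_; length; applyUpTo)
open import Data.List.Properties using (length-applyUpTo; length-removeAt′; ∷-injective; ++-identityʳ; ++-conicalʳ)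
open import Data.List.Membership.Propositional using (_∈_; _─_)
open import Data.List.Relation.Unary.Any using (here; there; index)
open import Data.List.Relation.Unary.All using (lookup; tabulate)
open import Data.List.Relation.Unary.Unique.Propositional using (Unique)
open import Data.List.Relation.Unary.AllPairs using (_∷_)
open import Data.List.Relation.Binary.Subset.Propositional using (_⊆_)
open import Data.List.Relation.Binary.Pointwise using (Pointwise-≡⇒≡; ≡⇒Pointwise-≡)
open import Data.List.Relation.Binary.Lex.Core using (halt; this; next)
open import Data.List.Relation.Binary.Lex.Strict using (Lex-<)
  renaming (<-isStrictTotalOrder to Lex-<-isStrictTotalOrder; <-irreflexive to Lex-<-irreflexive)
open import Data.Product using (∃; _×_; _,_; proj₁; proj₂)
open import Data.Sum using (_⊎_; inj₁; inj₂)
open import Data.Empty using (⊥-elim)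
open import Function using (flip; _∘_)
open import Function.Bundles using (_⇔_; mk⇔; Equivalence)
open import Relation.Nullary using (¬_; yes; no)
open import Relation.Binary using (IsStrictTotalOrder; tri<; tri≈; tri>)
import Relation.Binary.Construct.Flip.EqAndOrd as Flip
open import Relation.Binary.PropositionalEquality

module _ {B : Set} where

  ∈-─ : ∀ {x y : B} {xs} (x∈xs : x ∈ xs) → y ∈ xs → x ≢ y → y ∈ xs ─ x∈xs
  ∈-─ (here refl)  (here refl)  x≢y = ⊥-elim (x≢y refl)
  ∈-─ (here refl)  (there y∈xs) _   = y∈xs
  ∈-─ (there _)    (here refl)  _   = here refl
  ∈-─ (there x∈xs) (there y∈xs) x≢y = there (∈-─ x∈xs y∈xs x≢y)

  Unique-⊆⇒length≤ : ∀ {xs ys : List B} → Unique xs → xs ⊆ ys → length xs ≤ length ys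
  Unique-⊆⇒length≤ {[]} _ _ = z≤n
  Unique-⊆⇒length≤ {x ∷ xs} {ys} (x∉xs ∷ uxs) xs⊆ys =
    subst (suc (length xs) ≤_) (sym (length-removeAt′ ys (index x∈ys)))
      (s≤s (Unique-⊆⇒length≤ uxs λ z∈xs → ∈-─ x∈ys (xs⊆ys (there z∈xs)) (lookup x∉xs z∈xs)))
    where x∈ys = xs⊆ys (here refl)

module _ {B : Set} (U : ℕ → B) where

  sub-cons : ∀ {i e} → i ≤ e → sub U i e ≡ U i ∷ sub U (suc i) e
  sub-cons {i} {e} i≤e =
    trans (cong (applyUpTo (λ k → U (i + k))) (+-∸-assoc 1 i≤e))
          (cong₂ _∷_ (cong U (+-identityʳ i)) (applyUpTo-cong (e ∸ i) (λ k → cong U (+-suc i k))))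
    where
      applyUpTo-cong : ∀ {f g : ℕ → B} k → (∀ r → f r ≡ g r) → applyUpTo f k ≡ applyUpTo g k
      applyUpTo-cong zero    _   = refl
      applyUpTo-cong (suc k) f≗g = cong₂ _∷_ (f≗g 0) (applyUpTo-cong k (f≗g ∘ suc))

  sub-empty : ∀ {i e} → e < i → sub U i e ≡ []
  sub-empty {i} e<i = cong (applyUpTo (λ k → U (i + k))) (m≤n⇒m∸n≡0 e<i)

  sub-singleton : ∀ i → sub U i i ≡ U i ∷ []
  sub-singleton i = trans (sub-cons ≤-refl) (cong (U i ∷_) (sub-empty ≤-refl))

  sub≢[]⇒≤ : ∀ {i e} → sub U i e ≢ [] → i ≤ e
  sub≢[]⇒≤ {i} {e} sub≢[] with i ≤? e
  ... | yes i≤e = i≤e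
  ... | no i≰e  = ⊥-elim (sub≢[] (sub-empty (≰⇒> i≰e)))

  length-sub : ∀ i e → length (sub U i e) ≡ suc e ∸ i
  length-sub i e = length-applyUpTo (λ k → U (i + k)) (suc e ∸ i)

  sub≡∷ : ∀ {i e x X} → sub U i e ≡ x ∷ X → i ≤ e × U i ≡ x × X ≡ sub U (suc i) e
  sub≡∷ {i} {e} eq with i ≤? e
  ... | no i≰e with () ← trans (sym (sub-empty (≰⇒> i≰e))) eq
  ... | yes i≤e with refl , refl ← ∷-injective (trans (sym eq) (sub-cons i≤e)) = i≤e , refl , refl

  sub≡++ : ∀ {i e} V {X} → sub U i e ≡ V ++ X → X ≡ sub U (i + length V) e
  sub≡++ {i} {e} [] eq = trans (sym eq) (cong (λ k → sub U k e) (sym (+-identityʳ i)))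
  sub≡++ {i} {e} (v ∷ V) eq with _ , _ , tail ← sub≡∷ eq =
    trans (sub≡++ V (sym tail)) (cong (λ k → sub U k e) (sym (+-suc i (length V))))

  sub-common-prefix : ∀ {i e i′ e′} V {X Y} → sub U i e ≡ V ++ X → sub U i′ e′ ≡ V ++ Y →
                      ∀ r → r < length V → U (i + r) ≡ U (i′ + r)
  sub-common-prefix {i} {_} {i′} (v ∷ V) eq eq′ zero _
    with _ , Ui≡v , _ ← sub≡∷ eq | _ , Ui′≡v , _ ← sub≡∷ eq′ =
    trans (cong U (+-identityʳ i)) (trans Ui≡v (trans (sym Ui′≡v) (cong U (sym (+-identityʳ i′)))))
  sub-common-prefix {i} {_} {i′} (v ∷ V) eq eq′ (suc r) (s≤s r<V)
    with _ , _ , tail ← sub≡∷ eq | _ , _ , tail′ ← sub≡∷ eq′ =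
    trans (cong U (+-suc i r))
      (trans (sub-common-prefix V (sym tail) (sym tail′) r r<V) (cong U (sym (+-suc i′ r))))

module _ {B : Set} {R : B → B → Set} where

  Lex-<-extension : ∀ X {Z} → Z ≢ [] → Lex-< _≡_ R X (X ++ Z)
  Lex-<-extension []      {[]}    Z≢[] = ⊥-elim (Z≢[] refl)
  Lex-<-extension []      {_ ∷ _} _    = halt
  Lex-<-extension (x ∷ X) Z≢[]         = next refl (Lex-<-extension X Z≢[])

  Lex-<-divergence : ∀ u {a b v w} → R a b → Lex-< _≡_ R (u ++ a ∷ v) (u ++ b ∷ w)
  Lex-<-divergence []      Rab = this Rab
  Lex-<-divergence (x ∷ u) Rab = next refl (Lex-<-divergence u Rab)

  LexLt⇒Lex-< : ∀ {X Y} → LexLt R X Y → Lex-< _≡_ R X Y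
  LexLt⇒Lex-< {X} (inj₁ (Z , Z≢[] , refl)) = Lex-<-extension X Z≢[]
  LexLt⇒Lex-< (inj₂ (u , a , b , v , w , refl , refl , Rab)) = Lex-<-divergence u Rab

  LexLt-∷ : ∀ {x X Y} → LexLt R X Y → LexLt R (x ∷ X) (x ∷ Y)
  LexLt-∷ (inj₁ (Z , Z≢[] , refl)) = inj₁ (Z , Z≢[] , refl)
  LexLt-∷ {x} (inj₂ (u , a , b , v , w , refl , refl , Rab)) =
    inj₂ (x ∷ u , a , b , v , w , refl , refl , Rab)

  Lex-<⇒LexLt : ∀ {X Y} → Lex-< _≡_ R X Y → LexLt R X Y
  Lex-<⇒LexLt (halt {y} {Y})             = inj₁ (y ∷ Y , (λ ()) , refl)
  Lex-<⇒LexLt (this {x} {X} {y} {Y} Rxy) = inj₂ ([] , x , y , X , Y , refl , refl , Rxy)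
  Lex-<⇒LexLt (next refl X<Y)            = LexLt-∷ (Lex-<⇒LexLt X<Y)

  divergence⇒¬Prefix : ∀ (u : List B) {a b v w} → a ≢ b → ¬ Prefix (u ++ a ∷ v) (u ++ b ∷ w)
  divergence⇒¬Prefix []      a≢b (Z , eq) = a≢b (sym (proj₁ (∷-injective eq)))
  divergence⇒¬Prefix (x ∷ u) a≢b (Z , eq) = divergence⇒¬Prefix u a≢b (Z , proj₂ (∷-injective eq))

  LMSLt⇔flipped-LexLt : (∀ {a} → ¬ R a a) → ∀ {X Y} → LMSLt R X Y ⇔ LexLt (flip R) Y X
  LMSLt⇔flipped-LexLt R-irrefl = mk⇔ to from
    where
      to : ∀ {X Y} → LMSLt R X Y → LexLt (flip R) Y X
      to (inj₁ extension) = inj₁ extension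
      to (inj₂ (¬X⊑Y , _ , inj₁ (Z , _ , eq))) = ⊥-elim (¬X⊑Y (Z , eq))
      to (inj₂ (_ , _ , inj₂ (u , a , b , v , w , ex , ey , Rab))) = inj₂ (u , b , a , w , v , ey , ex , Rab)

      from : ∀ {X Y} → LexLt (flip R) Y X → LMSLt R X Y
      from (inj₁ extension) = inj₁ extension
      from (inj₂ (u , b , a , w , v , refl , refl , Rab)) =
        inj₂ ( divergence⇒¬Prefix u (λ { refl → R-irrefl Rab })
             , divergence⇒¬Prefix u (λ { refl → R-irrefl Rab })
             , inj₂ (u , a , b , v , w , refl , refl , Rab))

module _ {B : Set} (_⊏_ : B → B → Set) (U : ℕ → B) (n : ℕ) where

  private
    _<ₗ_ : List B → List B → Set
    _<ₗ_ = Lex-< _≡_ _⊏_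

  suffix-next : ∀ {i j} → i ≤ n → j ≤ n → U i ≡ U j →
                sub U (suc i) n <ₗ sub U (suc j) n → sub U i n <ₗ sub U j n
  suffix-next i≤n j≤n Ui≡Uj l =
    subst₂ _<ₗ_ (sym (sub-cons U i≤n)) (sym (sub-cons U j≤n)) (next Ui≡Uj l)

  suffix-this : ∀ {i j} → i ≤ n → j ≤ n → U i ⊏ U j → sub U i n <ₗ sub U j n
  suffix-this i≤n j≤n Ui<Uj = subst₂ _<ₗ_ (sym (sub-cons U i≤n)) (sym (sub-cons U j≤n)) (this Ui<Uj)

  suffix-prepend : ∀ K {i j} → i + K ≤ n → j + K ≤ n → (∀ r → r < K → U (i + r) ≡ U (j + r)) →
                   sub U (i + K) n <ₗ sub U (j + K) n → sub U i n <ₗ sub U j n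
  suffix-prepend zero {i} {j} _ _ _ l =
    subst₂ (λ x y → sub U x n <ₗ sub U y n) (+-identityʳ i) (+-identityʳ j) l
  suffix-prepend (suc K) {i} {j} i+K≤n j+K≤n agree l =
    suffix-next (≤-trans (m≤m+n i (suc K)) i+K≤n) (≤-trans (m≤m+n j (suc K)) j+K≤n)
      (subst₂ (λ x y → U x ≡ U y) (+-identityʳ i) (+-identityʳ j) (agree 0 z<s))
      (suffix-prepend K (subst (_≤ n) (+-suc i K) i+K≤n) (subst (_≤ n) (+-suc j K) j+K≤n)
        (λ r r<K → subst₂ (λ x y → U x ≡ U y) (+-suc i r) (+-suc j r) (agree (suc r) (s≤s r<K)))
        (subst₂ (λ x y → sub U x n <ₗ sub U y n) (+-suc i K) (+-suc j K) l))

  suffix-extendˡ : ∀ {i e i′ e′} → sub U i e ≡ sub U i′ e′ → i ≤ e → e ≤ n → e′ ≤ n →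
                   sub U e n <ₗ sub U e′ n → sub U i n <ₗ sub U i′ n
  suffix-extendˡ {i} {e} {i′} {e′} eq i≤e e≤n e′≤n l =
    suffix-prepend (e ∸ i) (subst (_≤ n) (sym i+K≡e) e≤n) (subst (_≤ n) (sym i′+K≡e′) e′≤n) agree
      (subst₂ (λ x y → sub U x n <ₗ sub U y n) (sym i+K≡e) (sym i′+K≡e′) l)
    where
      i′≤e′ : i′ ≤ e′
      i′≤e′ = proj₁ (sub≡∷ U (trans (sym eq) (sub-cons U i≤e)))
      length-eq : suc (e ∸ i) ≡ suc (e′ ∸ i′)
      length-eq = begin
        suc (e ∸ i)           ≡⟨ +-∸-assoc 1 i≤e ⟨
        suc e ∸ i             ≡⟨ length-sub U i e ⟨
        length (sub U i e)    ≡⟨ cong length eq ⟩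
        length (sub U i′ e′)  ≡⟨ length-sub U i′ e′ ⟩
        suc e′ ∸ i′           ≡⟨ +-∸-assoc 1 i′≤e′ ⟩
        suc (e′ ∸ i′)         ∎
        where open ≡-Reasoning
      i+K≡e : i + (e ∸ i) ≡ e
      i+K≡e = m+[n∸m]≡n i≤e
      i′+K≡e′ : i′ + (e ∸ i) ≡ e′
      i′+K≡e′ = trans (cong (i′ +_) (suc-injective length-eq)) (m+[n∸m]≡n i′≤e′)
      agree : ∀ r → r < e ∸ i → U (i + r) ≡ U (i′ + r)
      agree r r<K = sub-common-prefix U (sub U i e) (sym (++-identityʳ _))
        (trans (sym eq) (sym (++-identityʳ _)))
        r (subst (r <_) (sym (trans (length-sub U i e) (+-∸-assoc 1 i≤e))) (m≤n⇒m≤1+n r<K))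

  suffix-divergence : ∀ {i e i′ e′} u {c d v w} → sub U i e ≡ u ++ c ∷ v → sub U i′ e′ ≡ u ++ d ∷ w →
                      e ≤ n → e′ ≤ n → c ⊏ d → sub U i n <ₗ sub U i′ n
  suffix-divergence u eq eq′ e≤n e′≤n c⊏d
    with q≤e , Uq≡c , _ ← sub≡∷ U (sym (sub≡++ U u eq))
       | q′≤e′ , Uq′≡d , _ ← sub≡∷ U (sym (sub≡++ U u eq′)) =
    suffix-prepend (length u) (≤-trans q≤e e≤n) (≤-trans q′≤e′ e′≤n) (sub-common-prefix U u eq eq′)
      (suffix-this (≤-trans q≤e e≤n) (≤-trans q′≤e′ e′≤n) (subst₂ _⊏_ (sym Uq≡c) (sym Uq′≡d) c⊏d))

module LMSOrder {A : Set} {_⊏_ : A → A → Set} (sto : IsStrictTotalOrder _≡_ _⊏_) where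

  ⊏-irrefl : ∀ {a} → ¬ a ⊏ a
  ⊏-irrefl = IsStrictTotalOrder.irrefl sto refl

  _≺_ : List A → List A → Set
  _≺_ = LMSLt _⊏_

  private
    module Lex≻ = IsStrictTotalOrder (Lex-<-isStrictTotalOrder (Flip.isStrictTotalOrder sto))

    ≺⇒Lex : ∀ {X Y} → X ≺ Y → Lex-< _≡_ (flip _⊏_) Y X
    ≺⇒Lex = LexLt⇒Lex-< ∘ Equivalence.to (LMSLt⇔flipped-LexLt ⊏-irrefl)

    Lex⇒≺ : ∀ {X Y} → Lex-< _≡_ (flip _⊏_) Y X → X ≺ Y
    Lex⇒≺ = Equivalence.from (LMSLt⇔flipped-LexLt ⊏-irrefl) ∘ Lex-<⇒LexLt

  ≺-irrefl : ∀ {X} → ¬ X ≺ X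
  ≺-irrefl X≺X = Lex≻.irrefl (≡⇒Pointwise-≡ refl) (≺⇒Lex X≺X)

  ≺-trans : ∀ {X Y Z} → X ≺ Y → Y ≺ Z → X ≺ Z
  ≺-trans X≺Y Y≺Z = Lex⇒≺ (Lex≻.trans (≺⇒Lex Y≺Z) (≺⇒Lex X≺Y))

  ≺-trichotomy : ∀ X Y → X ≺ Y ⊎ X ≡ Y ⊎ Y ≺ X
  ≺-trichotomy X Y with Lex≻.compare Y X
  ... | tri< Y>X _ _ = inj₁ (Lex⇒≺ Y>X)
  ... | tri≈ _ Y≋X _ = inj₂ (inj₁ (sym (Pointwise-≡⇒≡ Y≋X)))
  ... | tri> _ _ X>Y = inj₂ (inj₂ (Lex⇒≺ X>Y))

module SuffixOrder {A : Set} (_⊏_ : A → A → Set) (sto : IsStrictTotalOrder _≡_ _⊏_)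
    (n : ℕ) (T : ℕ → A) (sentinel-unique : ∀ i → 1 ≤ i → i < n → T i ≢ T n) where

  open IsStrictTotalOrder sto using (compare) renaming (trans to ⊏-trans)
  open LMSOrder sto

  ST LT LMS : ℕ → Set
  ST  = SType _⊏_ T n
  LT  = LType _⊏_ T n
  LMS = IsLMS _⊏_ T n

  suffix : ℕ → List A
  suffix i = sub T i n

  _<ₛ_ : List A → List A → Set
  _<ₛ_ = Lex-< _≡_ _⊏_

  L-step : ∀ {i} → LT i → suc i ≤ n × (T (suc i) ⊏ T i ⊎ (T (suc i) ≡ T i × LT (suc i)))
  L-step {i} (1≤i , i≤n , ¬Si) with si≤n ← ≤∧≢⇒< i≤n (λ { refl → ¬Si s-last }) | compare (T i) (T (suc i))
  ... | tri< Ti⊏Tsi _ _ = ⊥-elim (¬Si (s-lt si≤n Ti⊏Tsi))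
  ... | tri≈ _ Ti≡Tsi _ = si≤n , inj₂ (sym Ti≡Tsi , s≤s z≤n , si≤n , λ Ssi → ¬Si (s-eq si≤n Ti≡Tsi Ssi))
  ... | tri> _ _ Tsi⊏Ti = si≤n , inj₁ Tsi⊏Ti

  L-before-S : ∀ {h} → LT h → ST (suc h) → T (suc h) ⊏ T h
  L-before-S Lh Ssh with L-step Lh
  ... | _ , inj₁ Tsh⊏Th            = Tsh⊏Th
  ... | _ , inj₂ (_ , _ , _ , ¬Ssh) = ⊥-elim (¬Ssh Ssh)

  descent⇒L : ∀ {h} → 1 ≤ h → suc h ≤ n → T (suc h) ⊏ T h → LT h
  descent⇒L {h} 1≤h sh≤n Tsh⊏Th = 1≤h , <⇒≤ sh≤n , ¬Sh
    where
      ¬Sh : ¬ ST h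
      ¬Sh s-last            = <-irrefl refl sh≤n
      ¬Sh (s-lt _ Th⊏Tsh)   = ⊏-irrefl (⊏-trans Tsh⊏Th Th⊏Tsh)
      ¬Sh (s-eq _ Th≡Tsh _) = ⊏-irrefl (subst (T (suc h) ⊏_) Th≡Tsh Tsh⊏Th)

  L<S : ∀ {i j} → LT i → ST j → T i ≡ T j → suffix i <ₛ suffix j
  L<S (1≤i , i≤n , ¬Si) s-last Ti≡Tn =
    ⊥-elim (sentinel-unique _ 1≤i (≤∧≢⇒< i≤n λ { refl → ¬Si s-last }) Ti≡Tn)
  L<S {i} {j} Li@(_ , i≤n , _) (s-lt sj≤n Tj⊏Tsj) Ti≡Tj with L-step Li
  ... | si≤n , inj₁ Tsi⊏Ti =
    suffix-next _⊏_ T n i≤n (<⇒≤ sj≤n) Ti≡Tj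
      (suffix-this _⊏_ T n si≤n sj≤n (⊏-trans Tsi⊏Ti (subst (_⊏ T (suc j)) (sym Ti≡Tj) Tj⊏Tsj)))
  ... | si≤n , inj₂ (Tsi≡Ti , _) =
    suffix-next _⊏_ T n i≤n (<⇒≤ sj≤n) Ti≡Tj
      (suffix-this _⊏_ T n si≤n sj≤n (subst (_⊏ T (suc j)) (sym (trans Tsi≡Ti Ti≡Tj)) Tj⊏Tsj))
  L<S {i} {j} Li@(_ , i≤n , _) (s-eq sj≤n Tj≡Tsj Ssj) Ti≡Tj with L-step Li
  ... | si≤n , inj₁ Tsi⊏Ti =
    suffix-next _⊏_ T n i≤n (<⇒≤ sj≤n) Ti≡Tj
      (suffix-this _⊏_ T n si≤n sj≤n (subst (T (suc i) ⊏_) (trans Ti≡Tj Tj≡Tsj) Tsi⊏Ti))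
  ... | _ , inj₂ (Tsi≡Ti , Lsi) =
    suffix-next _⊏_ T n i≤n (<⇒≤ sj≤n) Ti≡Tj (L<S Lsi Ssj (trans Tsi≡Ti (trans Ti≡Tj Tj≡Tsj)))

  module Phrases (m : ℕ) (p : ℕ → ℕ) (enum : IsLMSEnum _⊏_ T n m p) (pm : p m ≡ n) where

    ph : ℕ → List A
    ph = phr T n m p

    p-step : ∀ {t} → 1 ≤ t → t < m → p t < p (suc t)
    p-step = proj₁ enum _

    p-LMS : ∀ {t} → 1 ≤ t → t ≤ m → LMS (p t)
    p-LMS = proj₁ (proj₂ enum) _

    p≤n : ∀ {t} → 1 ≤ t → t ≤ m → p t ≤ n
    p≤n 1≤t t≤m = proj₁ (proj₂ (p-LMS 1≤t t≤m))

    p-mono : ∀ {s t} → 1 ≤ s → s < t → t ≤ m → p s < p t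
    p-mono {s} {suc t} 1≤s s<st st≤m with m<1+n⇒m<n∨m≡n s<st
    ... | inj₂ refl = p-step 1≤s st≤m
    ... | inj₁ s<t  = <-trans (p-mono 1≤s s<t (<⇒≤ st≤m)) (p-step (≤-trans 1≤s (<⇒≤ s<t)) st≤m)

    no-LMS-inside-phrase : ∀ {a i} → 1 ≤ a → a < m → p a < i → i < p (suc a) → ¬ LMS i
    no-LMS-inside-phrase {a} 1≤a a<m pa<i i<psa LMSi with proj₂ (proj₂ enum) _ LMSi
    ... | t , 1≤t , t≤m , refl with <-cmp t a
    ...   | tri< t<a _ _  = <-asym pa<i (p-mono 1≤t t<a (<⇒≤ a<m))
    ...   | tri≈ _ refl _ = <-irrefl refl pa<i
    ...   | tri> _ _ a<t with m≤n⇒m<n∨m≡n a<t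
    ...     | inj₁ sa<t  = <-asym i<psa (p-mono (s≤s z≤n) sa<t t≤m)
    ...     | inj₂ refl  = <-irrefl refl i<psa

    phrase≡sub : ∀ {a} → a < m → ph a ≡ sub T (p a) (p (suc a))
    phrase≡sub {a} a<m with a <ᵇ m | <⇒<ᵇ a<m
    ... | true | _ = refl

    last-phrase : ph m ≡ T n ∷ []
    last-phrase with m <ᵇ m | <ᵇ⇒< m m
    ... | false | _      = sub-singleton T n
    ... | true  | m<ᵇm⇒ = ⊥-elim (<-irrefl refl (m<ᵇm⇒ _))

    phrase-within : ∀ {a} → 1 ≤ a → a ≤ m → ∃ λ e → p a ≤ e × e ≤ n × ph a ≡ sub T (p a) e
    phrase-within 1≤a a≤m with m≤n⇒m<n∨m≡n a≤m
    ... | inj₁ a<m  = p (suc _) , <⇒≤ (p-step 1≤a a<m) , p≤n (s≤s z≤n) a<m , phrase≡sub a<m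
    ... | inj₂ refl = n , ≤-reflexive pm , ≤-refl ,
                      trans last-phrase (trans (sym (sub-singleton T n)) (cong (λ i → sub T i n) (sym pm)))

    phrase∈D : ∀ {a} → 1 ≤ a → a ≤ m → InD T n m p (ph a)
    phrase∈D 1≤a a≤m with m≤n⇒m<n∨m≡n a≤m
    ... | inj₁ a<m  = inj₁ (_ , 1≤a , a<m , phrase≡sub a<m)
    ... | inj₂ refl = inj₂ (trans last-phrase (sym (sub-singleton T n)))

    inner-phrase≢sentinel∷ : ∀ {a X} → 1 ≤ a → a < m → ph a ≢ T n ∷ X
    inner-phrase≢sentinel∷ {a} 1≤a a<m eq with _ , Tpa≡Tn , _ ← sub≡∷ T (trans (sym (phrase≡sub a<m)) eq) =
      sentinel-unique (p a) (<⇒≤ (proj₁ (p-LMS 1≤a (<⇒≤ a<m))))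
        (<-≤-trans (p-step 1≤a a<m) (p≤n (s≤s z≤n) a<m)) Tpa≡Tn

    ≡last-phrase : ∀ {a} → 1 ≤ a → a ≤ m → ph a ≡ ph m → a ≡ m
    ≡last-phrase 1≤a a≤m eq with m≤n⇒m<n∨m≡n a≤m
    ... | inj₁ a<m  = ⊥-elim (inner-phrase≢sentinel∷ 1≤a a<m (trans eq last-phrase))
    ... | inj₂ a≡m = a≡m

    suffix-of-phrase : ∀ {t S} → t < m → S ≢ [] → Suffix S (ph t) →
                       S ≡ sub T (p (suc t) + 1 ∸ length S) (p (suc t))
    suffix-of-phrase {t} {S} t<m S≢[] (U , ph≡U++S) = subst (λ i → S ≡ sub T i e) (sym start) S≡
      where
        e = p (suc t)
        q = p t + length U
        S≡ : S ≡ sub T q e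
        S≡ = sub≡++ T U (trans (sym (phrase≡sub t<m)) ph≡U++S)
        start : e + 1 ∸ length S ≡ q
        start = begin
          e + 1 ∸ length S     ≡⟨ cong₂ _∸_ (+-comm e 1) (trans (cong length S≡) (length-sub T q e)) ⟩
          suc e ∸ (suc e ∸ q)  ≡⟨ m∸[m∸n]≡n (m≤n⇒m≤1+n (sub≢[]⇒≤ T (S≢[] ∘ trans S≡))) ⟩
          q                    ∎
          where open ≡-Reasoning

    copy-of-LMS-is-L : ∀ {a h h′} → 1 ≤ a → a < m → p a ≤ h → suc h < p (suc a) → LMS (suc h′) →
                       T h ≡ T h′ → T (suc h) ≡ T (suc h′) → LT (suc h)
    copy-of-LMS-is-L 1≤a a<m pa≤h sh<psa (_ , _ , Ssh′ , Lh′) Th≡Th′ Tsh≡Tsh′ = s≤s z≤n , sh≤n , ¬Ssh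
      where
        sh≤n = <⇒≤ (<-≤-trans sh<psa (p≤n (s≤s z≤n) a<m))
        1≤h  = ≤-trans (<⇒≤ (proj₁ (p-LMS 1≤a (<⇒≤ a<m)))) pa≤h
        Lh   = descent⇒L 1≤h sh≤n (subst₂ _⊏_ (sym Tsh≡Tsh′) (sym Th≡Th′) (L-before-S Lh′ Ssh′))
        ¬Ssh = λ Ssh → no-LMS-inside-phrase 1≤a a<m (s≤s pa≤h) sh<psa (s≤s 1≤h , sh≤n , Ssh , Lh)

    extension-order′ : ∀ {a b Z} → 1 ≤ a → a < m → 1 ≤ b → b < m → ph a ≡ ph b ++ Z → Z ≢ [] →
                       suffix (p a) <ₛ suffix (p b)
    extension-order′ {a} {b} {Z} 1≤a a<m 1≤b b<m ext Z≢[]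
      with k , sh′≡e ← m≤n⇒∃[o]m+o≡n (p-step 1≤b b<m) =
      suffix-prepend _⊏_ T n k h≤n h′≤n (λ r r<k → agree r (m≤n⇒m≤1+n (<⇒≤ r<k)))
        (suffix-next _⊏_ T n h≤n h′≤n Th≡Th′ (L<S copy-is-L (proj₁ (proj₂ (proj₂ LMSsh′))) Tsh≡Tsh′))
      where
        h  = p a + k
        h′ = p b + k
        e  = p (suc b)
        V = sub T (p b) e
        eqa : sub T (p a) (p (suc a)) ≡ V ++ Z
        eqa = trans (sym (phrase≡sub a<m)) (trans ext (cong (_++ Z) (phrase≡sub b<m)))
        length-V : length V ≡ suc (suc k)
        length-V = begin
          length V                        ≡⟨ length-sub T (p b) e ⟩
          suc e ∸ p b                     ≡⟨ cong (λ x → suc x ∸ p b) sh′≡e ⟨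
          2 + (p b + k) ∸ p b             ≡⟨ +-∸-assoc 2 (m≤m+n (p b) k) ⟩
          2 + (p b + k ∸ p b)             ≡⟨ cong (2 +_) (m+n∸m≡n (p b) k) ⟩
          suc (suc k)                     ∎
          where open ≡-Reasoning
        agree : ∀ r → r ≤ suc k → T (p a + r) ≡ T (p b + r)
        agree r r≤sk = sub-common-prefix T V eqa (sym (++-identityʳ V)) r
                         (subst (r <_) (sym length-V) (s≤s r≤sk))
        Th≡Th′ : T h ≡ T h′
        Th≡Th′ = agree k (n≤1+n k)
        Tsh≡Tsh′ : T (suc h) ≡ T (suc h′)
        Tsh≡Tsh′ = subst₂ (λ x y → T x ≡ T y) (+-suc (p a) k) (+-suc (p b) k) (agree (suc k) ≤-refl)
        sh<psa : suc h < p (suc a)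
        sh<psa = subst (_≤ p (suc a))
                   (trans (cong (p a +_) length-V) (trans (+-suc (p a) (suc k)) (cong suc (+-suc (p a) k))))
                   (sub≢[]⇒≤ T (Z≢[] ∘ trans (sub≡++ T V eqa)))
        h≤n : h ≤ n
        h≤n = <⇒≤ (<-≤-trans (<-trans (n<1+n _) sh<psa) (p≤n (s≤s z≤n) a<m))
        LMSsh′ : LMS (suc h′)
        LMSsh′ = subst LMS (sym sh′≡e) (p-LMS (s≤s z≤n) b<m)
        h′≤n : h′ ≤ n
        h′≤n = <⇒≤ (proj₁ (proj₂ LMSsh′))
        copy-is-L : LT (suc h)
        copy-is-L = copy-of-LMS-is-L 1≤a a<m (m≤m+n (p a) k) sh<psa LMSsh′ Th≡Th′ Tsh≡Tsh′

    extension-order : ∀ {a b Z} → 1 ≤ a → a ≤ m → 1 ≤ b → b ≤ m → ph a ≡ ph b ++ Z → Z ≢ [] →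
                      suffix (p a) <ₛ suffix (p b)
    extension-order {b = b} {Z} 1≤a a≤m 1≤b b≤m ext Z≢[] with m≤n⇒m<n∨m≡n a≤m | m≤n⇒m<n∨m≡n b≤m
    ... | inj₁ a<m  | inj₁ b<m  = extension-order′ 1≤a a<m 1≤b b<m ext Z≢[]
    ... | inj₁ a<m  | inj₂ refl = ⊥-elim (inner-phrase≢sentinel∷ 1≤a a<m (trans ext (cong (_++ Z) last-phrase)))
    ... | inj₂ refl | _ with e , pb≤e , _ , phb ← phrase-within 1≤b b≤m =
      ⊥-elim (Z≢[] (++-conicalʳ _ Z (proj₂ (∷-injective (begin
        T (p b) ∷ sub T (suc (p b)) e ++ Z  ≡⟨ cong (_++ Z) (trans phb (sub-cons T pb≤e)) ⟨
        ph b ++ Z                           ≡⟨ ext ⟨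
        ph m                                ≡⟨ last-phrase ⟩
        T n ∷ []                            ∎)))))
      where open ≡-Reasoning

    phrase-order : ∀ {a b} → 1 ≤ a → a ≤ m → 1 ≤ b → b ≤ m → ph a ≺ ph b → suffix (p a) <ₛ suffix (p b)
    phrase-order 1≤a a≤m 1≤b b≤m a≺b with Equivalence.to (LMSLt⇔flipped-LexLt ⊏-irrefl) a≺b
    ... | inj₁ (Z , Z≢[] , ext) = extension-order 1≤a a≤m 1≤b b≤m ext Z≢[]
    ... | inj₂ (u , d , c , w , v , eb , ea , c⊏d)
      with _ , _ , ea≤n , pha ← phrase-within 1≤a a≤m | _ , _ , eb≤n , phb ← phrase-within 1≤b b≤m =
      suffix-divergence _⊏_ T n u (trans (sym pha) ea) (trans (sym phb) eb) ea≤n eb≤n c⊏d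

    equal-phrase-order : ∀ {a b} → 1 ≤ a → a < m → b < m → ph a ≡ ph b →
                         suffix (p (suc a)) <ₛ suffix (p (suc b)) → suffix (p a) <ₛ suffix (p b)
    equal-phrase-order 1≤a a<m b<m eq =
      suffix-extendˡ _⊏_ T n (trans (sym (phrase≡sub a<m)) (trans eq (phrase≡sub b<m)))
        (<⇒≤ (p-step 1≤a a<m)) (p≤n (s≤s z≤n) a<m) (p≤n (s≤s z≤n) b<m)

    Rank : List A → ℕ → Set
    Rank = IsRank _⊏_ T n m p

    rank-unique : ∀ {X r s} → Rank X r → Rank X s → r ≡ s
    rank-unique (L , uL , memL , refl) (L′ , uL′ , memL′ , refl) =
      cong suc (≤-antisym (Unique-⊆⇒length≤ uL  (Equivalence.from (memL′ _) ∘ Equivalence.to (memL _)))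
                          (Unique-⊆⇒length≤ uL′ (Equivalence.from (memL _) ∘ Equivalence.to (memL′ _))))

    rank-mono : ∀ {X Y r s} → InD T n m p X → Rank X r → Rank Y s → X ≺ Y → r < s
    rank-mono {X} X∈D (L , uL , memL , refl) (L′ , _ , memL′ , refl) X≺Y =
      s≤s (Unique-⊆⇒length≤ (tabulate X∉L ∷ uL) X∷L⊆L′)
      where
        X∉L : ∀ {Z} → Z ∈ L → X ≢ Z
        X∉L Z∈L refl = ≺-irrefl (proj₂ (Equivalence.to (memL X) Z∈L))
        X∷L⊆L′ : X ∷ L ⊆ L′
        X∷L⊆L′ (here refl)  = Equivalence.from (memL′ X) (X∈D , X≺Y)
        X∷L⊆L′ (there Z∈L) with Z∈D , Z≺X ← Equivalence.to (memL _) Z∈L =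
          Equivalence.from (memL′ _) (Z∈D , ≺-trans Z≺X X≺Y)

    module Parse (T′ : ℕ → ℕ) (parse : IsParse _⊏_ T n m p T′) where

      rank : ∀ {a} → 1 ≤ a → a ≤ m → Rank (ph a) (T′ a)
      rank = parse _

      parse-< : ∀ {a b} → 1 ≤ a → a ≤ m → 1 ≤ b → b ≤ m → T′ a < T′ b → ph a ≺ ph b
      parse-< {a} {b} 1≤a a≤m 1≤b b≤m T′a<T′b with ≺-trichotomy (ph a) (ph b)
      ... | inj₁ a≺b        = a≺b
      ... | inj₂ (inj₁ a≡b) =
        ⊥-elim (<-irrefl (rank-unique (rank 1≤a a≤m) (subst (λ X → Rank X (T′ b)) (sym a≡b) (rank 1≤b b≤m))) T′a<T′b)
      ... | inj₂ (inj₂ b≺a) =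
        ⊥-elim (<-asym T′a<T′b (rank-mono (phrase∈D 1≤b b≤m) (rank 1≤b b≤m) (rank 1≤a a≤m) b≺a))

      parse-≡ : ∀ {a b} → 1 ≤ a → a ≤ m → 1 ≤ b → b ≤ m → T′ a ≡ T′ b → ph a ≡ ph b
      parse-≡ {a} {b} 1≤a a≤m 1≤b b≤m T′a≡T′b with ≺-trichotomy (ph a) (ph b)
      ... | inj₁ a≺b        =
        ⊥-elim (<-irrefl T′a≡T′b (rank-mono (phrase∈D 1≤a a≤m) (rank 1≤a a≤m) (rank 1≤b b≤m) a≺b))
      ... | inj₂ (inj₁ a≡b) = a≡b
      ... | inj₂ (inj₂ b≺a) =
        ⊥-elim (<-irrefl (sym T′a≡T′b) (rank-mono (phrase∈D 1≤b b≤m) (rank 1≤b b≤m) (rank 1≤a a≤m) b≺a))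

      suffix-order : ∀ {X Y} → Lex-< _≡_ _<_ X Y → ∀ {a b} → 1 ≤ a → a ≤ m → 1 ≤ b → b ≤ m →
                     X ≡ sub T′ a m → Y ≡ sub T′ b m → suffix (p a) <ₛ suffix (p b)
      suffix-order halt _ a≤m _ _ X≡ _ with () ← trans X≡ (sub-cons T′ a≤m)
      suffix-order (this x<y) 1≤a a≤m 1≤b b≤m X≡ Y≡
        with _ , T′a≡x , _ ← sub≡∷ T′ (sym X≡) | _ , T′b≡y , _ ← sub≡∷ T′ (sym Y≡) =
        phrase-order 1≤a a≤m 1≤b b≤m (parse-< 1≤a a≤m 1≤b b≤m (subst₂ _<_ (sym T′a≡x) (sym T′b≡y) x<y))
      suffix-order (next refl X′<Y′) {a} {b} 1≤a a≤m 1≤b b≤m X≡ Y≡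
        with _ , T′a≡x , X′≡ ← sub≡∷ T′ (sym X≡) | _ , T′b≡x , Y′≡ ← sub≡∷ T′ (sym Y≡)
        with pha≡phb ← parse-≡ 1≤a a≤m 1≤b b≤m (trans T′a≡x (sym T′b≡x)) | a <? m
      ... | yes a<m =
        equal-phrase-order 1≤a a<m b<m pha≡phb (suffix-order X′<Y′ (s≤s z≤n) a<m (s≤s z≤n) b<m X′≡ Y′≡)
        where
          b<m : b < m
          b<m = ≤∧≢⇒< b≤m λ { refl → <-irrefl (≡last-phrase 1≤a a≤m pha≡phb) a<m }
      ... | no a≮m = ⊥-elim (Lex-<-irreflexive <-irrefl (≡⇒Pointwise-≡ X′≡Y′) X′<Y′)
        where
          a≡m = ≤-antisym a≤m (≮⇒≥ a≮m)
          a≡b : a ≡ b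
          a≡b = trans a≡m (sym (≡last-phrase 1≤b b≤m (trans (sym pha≡phb) (cong ph a≡m))))
          X′≡Y′ = trans X′≡ (trans (cong (λ i → sub T′ (suc i) m) a≡b) (sym Y′≡))

suc-tj≡SA : ∀ SA m j → tj SA m j < m → suc (tj SA m j) ≡ SA j
suc-tj≡SA SA m j tj<m with 1 <ᵇ SA j | <ᵇ⇒< 1 (SA j)
... | true  | 1<SA = m+[n∸m]≡n (<⇒≤ (1<SA _))
... | false | _    = ⊥-elim (<-irrefl refl tj<m)

lemma6 : {A : Set} (_⊏_ : A → A → Set) → IsStrictTotalOrder _≡_ _⊏_ →
    (n : ℕ) (T : ℕ → A) → 1 ≤ n →
    (∀ a → a ≢ T n → T n ⊏ a) →
    (∀ i → 1 ≤ i → i < n → T i ≢ T n) →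
    (m : ℕ) (p : ℕ → ℕ) → 1 ≤ m → IsLMSEnum _⊏_ T n m p → p m ≡ n →
    (T′ : ℕ → ℕ) → IsParse _⊏_ T n m p T′ →
    (SA′ : ℕ → ℕ) → IsSA T′ m SA′ →
    (S : List A) → S ≢ [] → LeftMaximal T n m p S →
    (j j′ : ℕ) → 1 ≤ j → j < j′ → j′ ≤ m →
    tj SA′ m j < m → tj SA′ m j′ < m →
    ProperSuffix S (Fj T n m p SA′ j) → ProperSuffix S (Fj T n m p SA′ j′) →
    LexLt _⊏_
      (sub T (p (suc (tj SA′ m j)) + 1 ∸ length S) n)
      (sub T (p (suc (tj SA′ m j′)) + 1 ∸ length S) n)
lemma6 _⊏_ sto n T _ _ sentinel-unique m p _ enum pm T′ parse SA′ (SA′-range , _ , SA′-sorted)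
       S S≢[] _ j j′ 1≤j j<j′ j′≤m tj<m tj′<m (U , _ , Fj≡) (U′ , _ , Fj′≡) =
  Lex-<⇒LexLt (suffix-extendˡ _⊏_ T n (trans (sym S≡) S≡′) (sub≢[]⇒≤ T (S≢[] ∘ trans S≡))
                 (p≤n (s≤s z≤n) tj<m) (p≤n (s≤s z≤n) tj′<m) phrase-ends-ordered)
  where
    open SuffixOrder _⊏_ sto n T sentinel-unique
    open Phrases m p enum pm
    open Parse T′ parse
    S≡  = suffix-of-phrase tj<m  S≢[] (U , Fj≡)
    S≡′ = suffix-of-phrase tj′<m S≢[] (U′ , Fj′≡)
    range  = SA′-range j 1≤j (<⇒≤ (<-≤-trans j<j′ j′≤m))
    range′ = SA′-range j′ (≤-trans 1≤j (<⇒≤ j<j′)) j′≤m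
    phrase-ends-ordered : suffix (p (suc (tj SA′ m j))) <ₛ suffix (p (suc (tj SA′ m j′)))
    phrase-ends-ordered =
      subst₂ (λ a b → suffix (p a) <ₛ suffix (p b)) (sym (suc-tj≡SA SA′ m j tj<m)) (sym (suc-tj≡SA SA′ m j′ tj′<m))
        (suffix-order (LexLt⇒Lex-< (SA′-sorted j j′ 1≤j j<j′ j′≤m))
          (proj₁ range) (proj₂ range) (proj₁ range′) (proj₂ range′) refl refl)
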